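{- Let $\mathcal F$ be a $1$-dense union-closed family over $[n]$ and let $A,B,C\in\mathcal F$. Then: (1) if $A\subsetneq_{\mathcal F}B$ and $B\subseteq C$, then $A\subsetneq_{\mathcal F}C$; (2) if $A\subsetneq B$ and $B\subseteq C$, then $B\subseteq_{\mathcal F}C$.
   Context: A family of subsets of $[n]$ is union-closed over $[n]$ if it contains $[n]$ and is closed under pairwise unions; the empty set is never a member of any family, and $2^{[n]}$ denotes all nonempty subsets of $[n]$. The closure of $\mathcal F$ is $\overline{\mathcal F}=\{A\in 2^{[n]}:\ \mathcal F\cup\{A\}\text{ is union-closed}\}$; $\mathcal F$ is $1$-dense if $\mathcal F\ne 2^{[n]}$ and $\overline{\mathcal F}=2^{[n]}$. Relative subsets: for a union-closed $\mathcal F$ and $A,B\in\mathcal F$, $A\subseteq_{\mathcal F}B$ means that $A=B$, or $B=[n]$, or there exists $C\in\mathcal F$ with $C\neq B$ and $A\cup C=B$. $A\subsetneq_{\mathcal F}B$ means $A\subseteq_{\mathcal F}B$ and $A\ne B$. -}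

module Defs where

open import Data.Nat using (ℕ)
open import Data.Fin.Subset using (Subset; _∪_; _⊆_; ⊤; Nonempty)
open import Data.Product using (Σ; _×_; ∃-syntax)
open import Data.Sum using (_⊎_)
open import Relation.Binary.PropositionalEquality using (_≡_; _≢_)
open import Relation.Nullary using (¬_)

-- A family of subsets of [n] = {0,…,n-1}, given as a membership predicate.
Family : ℕ → Set₁
Family n = Subset n → Set

insert : ∀ {n} → Family n → Subset n → Family n
insert F A X = F X ⊎ X ≡ A

UnionClosed : ∀ {n} → Family n → Set
UnionClosed {n} F =
  (∀ X → F X → Nonempty X) ×
  F ⊤ ×
  (∀ X Y → F X → F Y → F (X ∪ Y))

Closure : ∀ {n} → Family n → Family n
Closure F A = Nonempty A × UnionClosed (insert F A)

-- 1-dense: F ≠ 2^[n] (some nonempty set is missing) and F̄ = 2^[n]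
OneDense : ∀ {n} → Family n → Set
OneDense {n} F =
  (Σ (Subset n) λ X → Nonempty X × ¬ F X) ×
  (∀ A → Nonempty A → Closure F A)

_⊆[_]_ : ∀ {n} → Subset n → Family n → Subset n → Set
_⊆[_]_ {n} A F B = A ≡ B ⊎ B ≡ ⊤ ⊎ (Σ (Subset n) λ C → F C × C ≢ B × A ∪ C ≡ B)

_⊊[_]_ : ∀ {n} → Subset n → Family n → Subset n → Set
A ⊊[ F ] B = A ⊆[ F ] B × A ≢ B

_⊊_ : ∀ {n} → Subset n → Subset n → Set
A ⊊ B = A ⊆ B × A ≢ B

module Submission where

-- Density is used through one fact: in a 1-dense
-- union-closed family F, if D ∈ F and M is a nonempty set disjoint from D,
-- then D ∪ M ∈ F  (F ∪ {M} is union-closed, and D ∪ M = M is impossible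
-- because D is nonempty and disjoint from M).
--
-- Both parts of the theorem reduce to the following extension step.  Let
-- X ∪ D = B with D ∈ F, D ≠ B, and let B ⊊ C.  Put M = C ─ B and
-- E = D ∪ M.  Then E ∈ F by the density fact, E ≠ C because a point of
-- B ─ D lies in C but not in E, and X ∪ E = (X ∪ D) ∪ M = B ∪ M = C.
-- Hence X ⊆_F C with witness E.
--
-- Part (1) applies this with X = A and the witness D of A ⊊_F B (the
-- cases B = C and B = [n] being immediate); part (2) applies it with
-- X = B and D = A, using B ∪ A = B.

open import Defs
open import Data.Nat using (ℕ)
open import Data.Fin.Subset
  using (Subset; _∈_; _∉_; _⊆_; _∪_; _─_; ⊤; Nonempty; outside)
open import Data.Fin.Subset.Properties
  using (_∈?_; nonempty?; ⊆-antisym; ⊆⊤; p⊆p∪q; q⊆p∪q; x∈p∪q⁻; ∪-assoc;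
         p─q⊆p; x∈p∧x∉q⇒x∈p─q)
open import Data.Product using (_×_; _,_)
open import Data.Sum using (_⊎_; inj₁; inj₂)
open import Data.Vec using (_∷_; here; there)
open import Relation.Binary.PropositionalEquality
  using (_≡_; _≢_; refl; sym; cong; subst; module ≡-Reasoning)
open import Relation.Nullary using (yes; no; contradiction)

private
  variable
    n : ℕ

x∈p─q⇒x∉q : ∀ (p q : Subset n) {x} → x ∈ p ─ q → x ∉ q
x∈p─q⇒x∉q (s ∷ p) (outside ∷ q) here      ()
x∈p─q⇒x∉q (s ∷ p) (t ∷ q)       (there m) (there k) = x∈p─q⇒x∉q p q m k

-- A superset either equals the smaller set or has a point outside it;
-- constructively this is the usable form of "q ⊆ p and q ≠ p".
⊆⇒≡⊎difference : ∀ {p q : Subset n} → q ⊆ p → q ≡ p ⊎ Nonempty (p ─ q)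
⊆⇒≡⊎difference {p = p} {q} q⊆p with nonempty? (p ─ q)
... | yes ne = inj₂ ne
... | no empty = inj₁ (⊆-antisym q⊆p p⊆q)
  where
  p⊆q : p ⊆ q
  p⊆q {x} x∈p with x ∈? q
  ... | yes x∈q = x∈q
  ... | no x∉q = contradiction (x , x∈p∧x∉q⇒x∈p─q x∈p x∉q) empty

∪-absorbs-⊆ : ∀ {p q : Subset n} → p ⊆ q → q ∪ p ≡ q
∪-absorbs-⊆ {p = p} {q} p⊆q = ⊆-antisym q∪p⊆q (p⊆p∪q p)
  where
  q∪p⊆q : q ∪ p ⊆ q
  q∪p⊆q x∈q∪p with x∈p∪q⁻ q p x∈q∪p
  ... | inj₁ x∈q = x∈q
  ... | inj₂ x∈p = p⊆q x∈p

∪-difference : ∀ {p q : Subset n} → q ⊆ p → q ∪ (p ─ q) ≡ p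
∪-difference {p = p} {q} q⊆p = ⊆-antisym q∪p─q⊆p p⊆q∪p─q
  where
  q∪p─q⊆p : q ∪ (p ─ q) ⊆ p
  q∪p─q⊆p x∈ with x∈p∪q⁻ q (p ─ q) x∈
  ... | inj₁ x∈q   = q⊆p x∈q
  ... | inj₂ x∈p─q = p─q⊆p p q x∈p─q
  p⊆q∪p─q : p ⊆ q ∪ (p ─ q)
  p⊆q∪p─q {x} x∈p with x ∈? q
  ... | yes x∈q = p⊆p∪q (p ─ q) x∈q
  ... | no x∉q  = q⊆p∪q q (p ─ q) (x∈p∧x∉q⇒x∈p─q x∈p x∉q)

≢-⊆-trans : ∀ {a b c : Subset n} → a ⊆ b → b ⊆ c → a ≢ b → a ≢ c
≢-⊆-trans a⊆b b⊆c a≢b refl = a≢b (⊆-antisym a⊆b b⊆c)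

⊆[]⇒⊆ : ∀ {F : Family n} {a b : Subset n} → a ⊆[ F ] b → a ⊆ b
⊆[]⇒⊆ (inj₁ refl)                      = λ x∈a → x∈a
⊆[]⇒⊆ (inj₂ (inj₁ refl))               = ⊆⊤
⊆[]⇒⊆ (inj₂ (inj₂ (c , _ , _ , refl))) = p⊆p∪q c

dense-∪-disjoint : ∀ {F : Family n} → UnionClosed F → OneDense F →
  ∀ {D M} → F D → Nonempty M → (∀ {x} → x ∈ D → x ∉ M) → F (D ∪ M)
dense-∪-disjoint (nonemptyF , _ , _) (_ , dense) {D} {M} FD neM disjoint
  with dense M neM
... | _ , _ , _ , closed with closed D M (inj₁ FD) (inj₂ refl)
...   | inj₁ FD∪M = FD∪M
...   | inj₂ D∪M≡M with nonemptyF D FD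
...     | x , x∈D = contradiction (subst (x ∈_) D∪M≡M (p⊆p∪q M x∈D)) (disjoint x∈D)

-- If D ⊊ B ⊆ C, then D ∪ (C ─ B) misses a point of B ─ D, so it is not C.
∪-difference-≢ : ∀ {B C D : Subset n} → D ⊆ B → D ≢ B → B ⊆ C →
  D ∪ (C ─ B) ≢ C
∪-difference-≢ {B = B} {C} {D} D⊆B D≢B B⊆C D∪[C─B]≡C
  with ⊆⇒≡⊎difference D⊆B
... | inj₁ D≡B = D≢B D≡B
... | inj₂ (x , x∈B─D) with x∈p∪q⁻ D (C ─ B) x∈D∪[C─B]
  where
  x∈D∪[C─B] : x ∈ D ∪ (C ─ B)
  x∈D∪[C─B] = subst (x ∈_) (sym D∪[C─B]≡C) (B⊆C (p─q⊆p B D x∈B─D))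
...   | inj₁ x∈D   = x∈p─q⇒x∉q B D x∈B─D x∈D
...   | inj₂ x∈C─B = x∈p─q⇒x∉q C B x∈C─B (p─q⊆p B D x∈B─D)

extend-relative : ∀ {F : Family n} → UnionClosed F → OneDense F →
  ∀ {X D B C} → F D → X ∪ D ≡ B → D ≢ B → B ⊆ C → Nonempty (C ─ B) →
  X ⊆[ F ] C
extend-relative {F = F} uc od {X} {D} {B} {C} FD X∪D≡B D≢B B⊆C neC─B =
  inj₂ (inj₂ (D ∪ (C ─ B) , FE , ∪-difference-≢ D⊆B D≢B B⊆C , X∪E≡C))
  where
  D⊆B : D ⊆ B
  D⊆B = subst (D ⊆_) X∪D≡B (q⊆p∪q X D)
  FE : F (D ∪ (C ─ B))
  FE = dense-∪-disjoint uc od FD neC─B (λ x∈D x∈C─B → x∈p─q⇒x∉q C B x∈C─B (D⊆B x∈D))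
  X∪E≡C : X ∪ (D ∪ (C ─ B)) ≡ C
  X∪E≡C = begin
    X ∪ (D ∪ (C ─ B))  ≡⟨ sym (∪-assoc X D (C ─ B)) ⟩
    (X ∪ D) ∪ (C ─ B)  ≡⟨ cong (_∪ (C ─ B)) X∪D≡B ⟩
    B ∪ (C ─ B)        ≡⟨ ∪-difference B⊆C ⟩
    C                  ∎
    where open ≡-Reasoning

lemma7 : ∀ {n} (F : Family n) → UnionClosed F → OneDense F →
    ∀ (A B C : Subset n) → F A → F B → F C →
    ((A ⊊[ F ] B → B ⊆ C → A ⊊[ F ] C) ×
     (A ⊊ B → B ⊆ C → B ⊆[ F ] C))
lemma7 F uc od A B C FA _ _ = part1 , part2
  where
  enlarge : A ⊆[ F ] B → A ≢ B → B ⊆ C → A ⊆[ F ] C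
  enlarge (inj₁ A≡B)         A≢B _   = contradiction A≡B A≢B
  enlarge (inj₂ (inj₁ refl)) _   B⊆C = inj₂ (inj₁ (⊆-antisym ⊆⊤ B⊆C))
  enlarge A⊆[F]B@(inj₂ (inj₂ (D , FD , D≢B , A∪D≡B))) _ B⊆C
    with ⊆⇒≡⊎difference B⊆C
  ... | inj₁ refl  = A⊆[F]B
  ... | inj₂ neC─B = extend-relative uc od FD A∪D≡B D≢B B⊆C neC─B

  part1 : A ⊊[ F ] B → B ⊆ C → A ⊊[ F ] C
  part1 (A⊆[F]B , A≢B) B⊆C =
    enlarge A⊆[F]B A≢B B⊆C , ≢-⊆-trans (⊆[]⇒⊆ A⊆[F]B) B⊆C A≢B

  part2 : A ⊊ B → B ⊆ C → B ⊆[ F ] C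
  part2 (A⊆B , A≢B) B⊆C with ⊆⇒≡⊎difference B⊆C
  ... | inj₁ B≡C   = inj₁ B≡C
  ... | inj₂ neC─B = extend-relative uc od FA (∪-absorbs-⊆ A⊆B) A≢B B⊆C neC─B
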